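{- Let \((Y,\rho)\) be an ultrametric space, let \(C\), \(D\) be disjoint proximinal subsets of \(Y\), and let \(G=G_{Y,\rho}(C,D)\) be the corresponding proximinal graph. Then the following are equivalent: (i) \(G\) is connected; (ii) \(\operatorname{diam}(C\cup D)\le\operatorname{dist}(C,D)\); (iii) \(G\) is a complete bipartite graph.
   Context: An ultrametric on a nonempty set \(Y\) is a function \(\rho\colon Y\times Y\to[0,\infty)\) with \(\rho(x,y)=\rho(y,x)\), \(\rho(x,y)=0\iff x=y\) and \(\rho(x,y)\le\max\{\rho(x,z),\rho(z,y)\}\). A set \(C\subseteq Y\) is proximinal if for every \(y\in Y\) there is \(c_0\in C\) with \(\rho(y,c_0)=\inf\{\rho(y,c)\colon c\in C\}\). \(\operatorname{dist}(C,D)=\inf\{\rho(c,e)\colon c\in C,e\in D\}\); \(\operatorname{diam}(S)=\sup\{\rho(x,y)\colon x,y\in S\}\). \(G_{Y,\rho}(C,D)\) is the bipartite graph with vertex set \(C\cup D\), parts \(C\), \(D\), in which \(c\in C\), \(e\in D\) are adjacent iff \(\rho(c,e)=\operatorname{dist}(C,D)\). A graph is connected if any two distinct vertices are joined by a finite path in it. A complete bipartite graph is a bipartite graph in which every two vertices from different parts are adjacent. -}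

module Defs where

open import Level using (Level; _⊔_; suc)
open import Data.Product using (Σ; _×_; _,_)
open import Data.Sum using (_⊎_)
open import Data.Empty using (⊥)
open import Relation.Nullary using (¬_)
open import Relation.Binary.PropositionalEquality using (_≡_)
open import Relation.Binary.Bundles using (TotalOrder)

-- The value set of the metric: an abstract totally ordered set R with a
-- distinguished element 0 (for the paper, R = ℝ with its usual order).
-- Only the order structure of [0,∞) is used by all notions below.

record UltrametricSpace {c ℓ₁ ℓ₂ : Level} (R : TotalOrder c ℓ₁ ℓ₂) (a : Level)
       : Set (suc a ⊔ c ⊔ ℓ₁ ⊔ ℓ₂) where
  open TotalOrder R
  field
    0ᴿ    : Carrier
    Point : Set a
    pt    : Point
    ρ     : Point → Point → Carrier
    ρ-nonneg : ∀ x y → 0ᴿ ≤ ρ x y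
    ρ-sym    : ∀ x y → ρ x y ≈ ρ y x
    ρ-zero⇒  : ∀ x y → ρ x y ≈ 0ᴿ → x ≡ y
    ρ-⇒zero  : ∀ x y → x ≡ y → ρ x y ≈ 0ᴿ
    -- ρ x y ≤ max (ρ x z) (ρ z y), written without max (total order)
    ρ-ultra  : ∀ x y z → (ρ x y ≤ ρ x z) ⊎ (ρ x y ≤ ρ z y)

module _ {c ℓ₁ ℓ₂ a : Level} {R : TotalOrder c ℓ₁ ℓ₂} (Y : UltrametricSpace R a) where
  open TotalOrder R
  open UltrametricSpace Y

  Subset : ∀ p → Set (a ⊔ suc p)
  Subset p = Point → Set p

  module _ {p : Level} where

    Disjoint : Subset p → Subset p → Set (a ⊔ p)
    Disjoint C D = ∀ y → C y → D y → ⊥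

    -- ρ(y,c₀) = inf { ρ(y,c) : c ∈ C }  ⇔  ρ(y,c₀) is a lower bound
    Proximinal : Subset p → Set (a ⊔ p ⊔ ℓ₂)
    Proximinal C = ∀ y → Σ Point λ c₀ → C c₀ × (∀ c → C c → ρ y c₀ ≤ ρ y c)

    -- "r ≤ dist(C,D)": r is a lower bound of { ρ(c,e) : c ∈ C, e ∈ D }
    _≤dist[_,_] : Carrier → Subset p → Subset p → Set (a ⊔ p ⊔ ℓ₂)
    r ≤dist[ C , D ] = ∀ c e → C c → D e → r ≤ ρ c e

    -- c ∈ C and e ∈ D are adjacent in G(C,D) iff ρ(c,e) = dist(C,D);
    -- since dist(C,D) ≤ ρ(c,e) always, this is ρ(c,e) ≤ dist(C,D).
    Adj : Subset p → Subset p → Point → Point → Set (a ⊔ p ⊔ ℓ₂)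
    Adj C D c e = C c × D e × (ρ c e ≤dist[ C , D ])

    Vertex : Subset p → Subset p → Subset p
    Vertex C D y = C y ⊎ D y

    Edge : Subset p → Subset p → Point → Point → Set (a ⊔ p ⊔ ℓ₂)
    Edge C D x y = Adj C D x y ⊎ Adj C D y x

    data Path (C D : Subset p) : Point → Point → Set (a ⊔ p ⊔ ℓ₂) where
      [] : ∀ {x} → Path C D x x
      _∷_ : ∀ {x y z} → Edge C D x y → Path C D y z → Path C D x z

    Connected : Subset p → Subset p → Set (a ⊔ p ⊔ ℓ₂)
    Connected C D = ∀ x y → Vertex C D x → Vertex C D y → ¬ (x ≡ y) → Path C D x y

    DiamLeDist : Subset p → Subset p → Set (a ⊔ p ⊔ ℓ₂)
    DiamLeDist C D = ∀ x y → Vertex C D x → Vertex C D y → ρ x y ≤dist[ C , D ]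

    CompleteBipartite : Subset p → Subset p → Set (a ⊔ p ⊔ ℓ₂)
    CompleteBipartite C D = ∀ c e → C c → D e → Adj C D c e

-- Every edge of G(C,D) has length dist(C,D), so by the ultrametric inequality
-- the endpoints of any path are within dist(C,D) of each other; connectivity
-- thus bounds every cross distance by dist(C,D), and one more application of
-- the ultrametric inequality through a vertex of the other part bounds the
-- distances inside C and inside D.  Conversely, a complete bipartite graph on
-- nonempty parts is connected by paths of length at most two.
module Submission where

open import Defs
open import Level using (Level)
open import Data.Product using (Σ; _×_; _,_)
open import Data.Sum using (inj₁; inj₂)
open import Relation.Nullary using (¬_)
open import Relation.Binary.Bundles using (TotalOrder)
open import Relation.Binary.PropositionalEquality using (_≡_; refl; subst; sym)

module _ {c ℓ₁ ℓ₂ a : Level} {R : TotalOrder c ℓ₁ ℓ₂} (Y : UltrametricSpace R a) where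
  open TotalOrder R using (_≤_; trans; reflexive)
  open UltrametricSpace Y

  ρ-sym-≤ : ∀ {x y r} → ρ x y ≤ r → ρ y x ≤ r
  ρ-sym-≤ {x} {y} h = trans (reflexive (ρ-sym y x)) h

  ρ-ultra-≤ : ∀ {x y z r} → ρ x z ≤ r → ρ z y ≤ r → ρ x y ≤ r
  ρ-ultra-≤ {x} {y} {z} hxz hzy with ρ-ultra x y z
  ... | inj₁ h = trans h hxz
  ... | inj₂ h = trans h hzy

  proximinal⇒nonempty : ∀ {p} {C : Subset Y p} → Proximinal Y C → Σ Point C
  proximinal⇒nonempty prox with prox pt
  ... | c₀ , Cc₀ , _ = c₀ , Cc₀

  module _ {p : Level} (C D : Subset Y p) where

    disjoint⇒≢ : Disjoint Y C D → ∀ {x y} → C x → D y → ¬ x ≡ y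
    disjoint⇒≢ disj {x} Cx Dy x≡y = disj x Cx (subst D (sym x≡y) Dy)

    edge-≤-dist : ∀ {c e u v} → C c → D e → Edge Y C D u v → ρ u v ≤ ρ c e
    edge-≤-dist Cc De (inj₁ (_ , _ , uv≤dist)) = uv≤dist _ _ Cc De
    edge-≤-dist Cc De (inj₂ (_ , _ , vu≤dist)) = ρ-sym-≤ (vu≤dist _ _ Cc De)

    path-ρ-≤ : ∀ {x z r} → 0ᴿ ≤ r → (∀ {u v} → Edge Y C D u v → ρ u v ≤ r) →
               Path Y C D x z → ρ x z ≤ r
    path-ρ-≤ {x} 0≤r edge≤r []         = trans (reflexive (ρ-⇒zero x x refl)) 0≤r
    path-ρ-≤     0≤r edge≤r (uv ∷ vz) = ρ-ultra-≤ (edge≤r uv) (path-ρ-≤ 0≤r edge≤r vz)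

    connected⇒diam≤dist : Disjoint Y C D → Connected Y C D → DiamLeDist Y C D
    connected⇒diam≤dist disj conn x y vx vy c e Cc De = bound vx vy
      where
        cross : ∀ {u w} → C u → D w → ρ u w ≤ ρ c e
        cross Cu Dw = path-ρ-≤ (ρ-nonneg c e) (edge-≤-dist Cc De)
                        (conn _ _ (inj₁ Cu) (inj₂ Dw) (disjoint⇒≢ disj Cu Dw))

        bound : Vertex Y C D x → Vertex Y C D y → ρ x y ≤ ρ c e
        bound (inj₁ Cx) (inj₁ Cy) = ρ-ultra-≤ (cross Cx De) (ρ-sym-≤ (cross Cy De))
        bound (inj₁ Cx) (inj₂ Dy) = cross Cx Dy
        bound (inj₂ Dx) (inj₁ Cy) = ρ-sym-≤ (cross Cy Dx)
        bound (inj₂ Dx) (inj₂ Dy) = ρ-ultra-≤ (ρ-sym-≤ (cross Cc Dx)) (cross Cc Dy)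

    diam≤dist⇒complete : DiamLeDist Y C D → CompleteBipartite Y C D
    diam≤dist⇒complete diam≤dist c e Cc De = Cc , De , diam≤dist c e (inj₁ Cc) (inj₂ De)

    complete⇒connected : Σ Point C → Σ Point D → CompleteBipartite Y C D → Connected Y C D
    complete⇒connected _ _ complete x y (inj₁ Cx) (inj₂ Dy) _ =
      inj₁ (complete x y Cx Dy) ∷ []
    complete⇒connected _ _ complete x y (inj₂ Dx) (inj₁ Cy) _ =
      inj₂ (complete y x Cy Dx) ∷ []
    complete⇒connected _ (e , De) complete x y (inj₁ Cx) (inj₁ Cy) _ =
      inj₁ (complete x e Cx De) ∷ (inj₂ (complete y e Cy De) ∷ [])
    complete⇒connected (c , Cc) _ complete x y (inj₂ Dx) (inj₂ Dy) _ =
      inj₂ (complete c x Cc Dx) ∷ (inj₁ (complete c y Cc Dy) ∷ [])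

corollary3p3 : ∀ {c ℓ₁ ℓ₂ a p : Level} {R : TotalOrder c ℓ₁ ℓ₂}
                 (Y : UltrametricSpace R a) (C D : Subset Y p) →
                 Disjoint Y C D → Proximinal Y C → Proximinal Y D →
                 ((Connected Y C D → DiamLeDist Y C D)
                   × (DiamLeDist Y C D → CompleteBipartite Y C D)
                   × (CompleteBipartite Y C D → Connected Y C D))
corollary3p3 Y C D disj proxC proxD =
    connected⇒diam≤dist Y C D disj
  , diam≤dist⇒complete Y C D
  , complete⇒connected Y C D (proximinal⇒nonempty Y proxC) (proximinal⇒nonempty Y proxD)
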